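{- Let $0\le k\le n$ be integers and fix a derangement $\sigma\in D_k$. Let $\mathcal{A}$ be the set of standard labeled partitions $(\mu,\pi)$ with $\pi\in S_n$ and $dp(\pi)=\sigma$, and let $\mathcal{B}$ be the set of pairs $(\beta,\gamma)$ where $\beta=(\beta_1\ge\cdots\ge\beta_k\ge 0)$ and $\gamma=(\gamma_1\ge\cdots\ge\gamma_{n-k}\ge 0)$ are partitions with at most $k$ and at most $n-k$ parts respectively, such that $(\beta,\sigma)$ is a standard labeled partition. For $(\mu,\pi)\in\mathcal{A}$, let $i_1<\cdots<i_{n-k}$ be the fixed points of $\pi$ and $j_1<\cdots<j_k$ its derangement points, and set $$\varphi(\mu,\pi)=(\beta,\gamma),\qquad \beta=(\mu_{j_1},\mu_{j_2},\ldots,\mu_{j_k}),\quad \gamma=(\mu_{i_1},\mu_{i_2},\ldots,\mu_{i_{n-k}}).$$ Then $\varphi$ is a bijection from $\mathcal{A}$ to $\mathcal{B}$ (in particular $(\beta,\sigma)$ is a standard labeled partition for every $(\mu,\pi)\in\mathcal{A}$), and $|\mu|=|\beta|+|\gamma|$.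
   Context: $S_n$ is the set of permutations $\pi=\pi_1\pi_2\cdots\pi_n$ of $\{1,\ldots,n\}$. An index $i$ is a fixed point of $\pi$ if $\pi_i=i$ and a derangement point otherwise; $D_k$ is the set of permutations in $S_k$ with no fixed points. If the derangement points of $\pi$ are $p_1<\cdots<p_k$, then $dp(\pi)\in S_k$ is the permutation whose entries are in the same relative order as $\pi_{p_1},\pi_{p_2},\ldots,\pi_{p_k}$ (the standardization of this sequence); it lies in $D_k$. A partition with at most $m$ parts is a sequence $\lambda=(\lambda_1,\ldots,\lambda_m)$ of integers with $\lambda_1\ge\lambda_2\ge\cdots\ge\lambda_m\ge 0$, and $|\lambda|=\lambda_1+\cdots+\lambda_m$. A labeled partition is a pair $(\lambda,\pi)$ of a partition $\lambda$ with at most $m$ parts and a permutation $\pi\in S_m$; it is standard if for every $i$, $\pi_i>\pi_{i+1}$ implies $\lambda_i>\lambda_{i+1}$. -}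

module Defs where

open import Data.Nat using (ℕ; suc; _≤_; _<_; _<?_)
open import Data.Fin using (Fin; toℕ; _≟_)
open import Data.List using (List; map; filter; length; tabulate; allFin)
open import Data.Nat.ListAction using (sum)
open import Data.Product using (_×_; _,_)
open import Relation.Binary.PropositionalEquality using (_≡_; _≢_)
open import Relation.Nullary using (¬?)
open import Function.Definitions using (Bijective)

IsPerm : {m : ℕ} → (Fin m → Fin m) → Set
IsPerm π = Bijective _≡_ _≡_ π

IsDerangement : {m : ℕ} → (Fin m → Fin m) → Set
IsDerangement σ = IsPerm σ × (∀ i → σ i ≢ i)

IsPartition : {m : ℕ} → (Fin m → ℕ) → Set
IsPartition {m} lam = ∀ (i j : Fin m) → toℕ j ≡ suc (toℕ i) → lam j ≤ lam i

IsStandardLabeled : {m : ℕ} → (Fin m → ℕ) → (Fin m → Fin m) → Set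
IsStandardLabeled {m} lam π =
  IsPartition lam × IsPerm π ×
  (∀ (i j : Fin m) → toℕ j ≡ suc (toℕ i) → toℕ (π j) < toℕ (π i) → lam j < lam i)

size : {m : ℕ} → (Fin m → ℕ) → ℕ
size lam = sum (tabulate lam)

derangPts : {n : ℕ} → (Fin n → Fin n) → List (Fin n)
derangPts {n} π = filter (λ i → ¬? (π i ≟ i)) (allFin n)

fixPts : {n : ℕ} → (Fin n → Fin n) → List (Fin n)
fixPts {n} π = filter (λ i → π i ≟ i) (allFin n)

std : List ℕ → List ℕ
std xs = map (λ x → length (filter (_<? x) xs)) xs

dp : {n : ℕ} → (Fin n → Fin n) → List ℕ
dp π = std (map (λ i → toℕ (π i)) (derangPts π))

oneLine : {k : ℕ} → (Fin k → Fin k) → List ℕ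
oneLine σ = tabulate (λ i → toℕ (σ i))

InA : {n k : ℕ} → (Fin k → Fin k) → (Fin n → ℕ) → (Fin n → Fin n) → Set
InA σ μ π = IsStandardLabeled μ π × dp π ≡ oneLine σ

InB : {k r : ℕ} → (Fin k → Fin k) → (Fin k → ℕ) → (Fin r → ℕ) → Set
InB σ β γ = IsStandardLabeled β σ × IsPartition γ

φ : {n : ℕ} → (Fin n → ℕ) → (Fin n → Fin n) → List ℕ × List ℕ
φ μ π = map μ (derangPts π) , map μ (fixPts π)

-- Give each position p of π the key (μ p , c p), where c p is 0, 1 or 2 according as π p is
-- below, at or above p. For a standard labeled partition the keys are sorted: μ decreases weakly,
-- and on a level of μ the values of π increase, so c cannot decrease there. Since dp π = σ, π maps
-- the t-th derangement point to the σ(t)-th one, so the code at the t-th derangement point is the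
-- code of σ at t. The multiset of keys is therefore {(β t , c_σ t)} ∪ {(γ s , 1)}, which depends
-- only on φ(μ , π) and σ, and a sorted list is determined by its multiset: φ is injective.
-- Conversely, merging the key-sorted labels of β and γ fixes the order of the positions; letting π
-- act as σ on the labels of β and as the identity on those of γ gives the preimage of (β , γ).

module Submission where

open import Defs
open import Data.Bool using (true; false)
open import Data.Empty using (⊥)
open import Data.Fin as Fin using (Fin; zero; suc; toℕ; _≟_)
import Data.Fin.Properties as Fin
open import Data.Fin.Properties using (toℕ-injective)
open import Data.List using (List; []; _∷_; _++_; map; filter; merge; length; tabulate; allFin; lookup)
open import Data.List.Membership.Propositional using (_∈_)
open import Data.List.Membership.Propositional.Properties
  using (∈-lookup; ∈-++⁺ˡ; ∈-++⁺ʳ; ∈-filter⁺; ∈-filter⁻; ∈-tabulate⁺; ∈-tabulate⁻; ∈-allFin)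
open import Data.List.Membership.Propositional.Properties.WithK using (unique∧set⇒bag)
open import Data.List.Properties
  using (∷-injective; map-∘; map-id; map-cong; map-++; map-tabulate; length-map; length-++; length-tabulate;
         tabulate-lookup; tabulate-cong; filter-≐; filter-all; filter-none; filter-accept; filter-reject; partition-defn)
open import Data.List.Relation.Binary.BagAndSetEquality using (∼bag⇒↭)
open import Data.List.Relation.Binary.Permutation.Propositional
  using (_↭_; ↭-trans; ↭-sym; ↭⇒↭ₛ; ↭ₛ⇒↭; module PermutationReasoning)
open import Data.List.Relation.Binary.Permutation.Propositional.Properties
  using (↭-length; filter-↭; map⁺; merge-↭; ∈-resp-↭)
import Data.List.Relation.Binary.Permutation.Setoid.Properties as PermutationProperties
open import Data.List.Relation.Binary.Pointwise using (Pointwise-≡⇒≡)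
open import Data.List.Relation.Unary.All as All using (All; []; _∷_)
import Data.List.Relation.Unary.All.Properties as All
open import Data.List.Relation.Unary.AllPairs using (_∷_)
import Data.List.Relation.Unary.AllPairs.Properties as AllPairs
import Data.List.Relation.Unary.Any as Any
open import Data.List.Relation.Unary.Any.Properties using (lookup-index)
open import Data.List.Relation.Unary.Linked using (Linked; []; [-]; _∷_)
import Data.List.Relation.Unary.Linked.Properties as Linked
open import Data.List.Relation.Unary.Sorted.TotalOrder.Properties using (↗↭↗⇒≋; merge⁺)
open import Data.List.Relation.Unary.Unique.Propositional using (Unique)
import Data.List.Relation.Unary.Unique.Propositional.Properties as Unique
open import Data.Nat using (ℕ; zero; suc; _+_; _∸_; _≤_; _<_; _≥_; _<?_; z≤n; s≤s)
open import Data.Nat.ListAction using (sum)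
open import Data.Nat.ListAction.Properties using (sum-++; sum-↭)
open import Data.Nat.Properties
  using (<-cmp; <-irrefl; <-asym; <-trans; ≤-trans; ≤-refl; ≤-reflexive; ≤-antisym; ≤-total; ≤-pred;
         <⇒≤; <⇒≢; <⇒≯; ≤⇒≯; ≮⇒≥; ≤∧≢⇒<; m≤n⇒m<n∨m≡n; suc-injective; +-comm; m+n∸n≡m; m+[n∸m]≡n)
  renaming (_≟_ to _≟ℕ_; _≤?_ to _≤?ℕ_)
open import Data.Product using (Σ; ∃; _×_; _,_; proj₁; proj₂)
open import Data.Product.Properties using (≡-dec)
open import Data.Sum as Sum using (_⊎_; inj₁; inj₂; [_,_])
open import Data.Sum.Properties using (inj₁-injective; inj₂-injective)
open import Data.Unit using (⊤; tt)
open import Function using (_∘_; flip)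
open import Function.Bundles using (mk⇔)
open import Level using (Level; 0ℓ)
open import Relation.Binary.Bundles using (DecTotalOrder)
import Relation.Binary.Construct.On as On
open import Relation.Binary.Core using (Rel; _Preserves_⟶_)
open import Relation.Binary.Definitions using (Transitive; tri<; tri≈; tri>) renaming (Decidable to Decidable₂)
import Relation.Binary.PropositionalEquality as ≡
open import Relation.Binary.PropositionalEquality
  using (_≡_; _≢_; _≗_; refl; sym; trans; cong; cong₂; subst; subst₂)
open import Relation.Nullary using (¬_; ¬?; Dec; does; yes; no; contradiction; _×-dec_; _⊎-dec_)
open import Relation.Unary using (Pred; Decidable; ∁)
open import Relation.Unary.Properties using (∁?)

private
  variable
    a ℓ : Level
    A : Set a
    k m : ℕ

Stepwise : Rel A ℓ → (Fin m → A) → Set ℓ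
Stepwise R f = ∀ i j → toℕ j ≡ suc (toℕ i) → R (f i) (f j)

stepwise-suc : {R : Rel A ℓ} {f : Fin (suc m) → A} → Stepwise R f → Stepwise R (f ∘ suc)
stepwise-suc st i j e = st (suc i) (suc j) (cong suc e)

stepwise⇒ordered : {R : Rel A ℓ} {f : Fin m → A} → Transitive R → Stepwise R f →
  ∀ {s t} → toℕ s < toℕ t → R (f s) (f t)
stepwise⇒ordered tr st {zero} {suc zero} _ = st zero (suc zero) refl
stepwise⇒ordered {R = R} {f} tr st {zero} {suc (suc t)} _ =
  tr (st zero (suc zero) refl)
     (stepwise⇒ordered {R = R} {f ∘ suc} tr (stepwise-suc {R = R} {f} st) {zero} {suc t} (s≤s z≤n))
stepwise⇒ordered {R = R} {f} tr st {suc s} {suc t} (s≤s s<t) =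
  stepwise⇒ordered {R = R} {f ∘ suc} tr (stepwise-suc {R = R} {f} st) s<t

linked-tabulate⁺ : {R : Rel A ℓ} {f : Fin m → A} → Stepwise R f → Linked R (tabulate f)
linked-tabulate⁺ {m = zero} st = []
linked-tabulate⁺ {m = suc zero} st = [-]
linked-tabulate⁺ {m = suc (suc m)} {R = R} {f} st =
  st zero (suc zero) refl ∷ linked-tabulate⁺ {R = R} {f ∘ suc} (stepwise-suc {R = R} {f} st)

linked-tabulate⁻ : {R : Rel A ℓ} {f : Fin m → A} → Linked R (tabulate f) → Stepwise R f
linked-tabulate⁻ {m = suc (suc m)} (r ∷ rs) zero (suc zero) refl = r
linked-tabulate⁻ {m = suc (suc m)} {R = R} {f} (r ∷ rs) (suc i) (suc j) e =
  linked-tabulate⁻ {R = R} {f ∘ suc} rs i j (suc-injective e)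

tabulate-injective : {f g : Fin m → A} → tabulate f ≡ tabulate g → f ≗ g
tabulate-injective {m = suc m} e zero = proj₁ (∷-injective e)
tabulate-injective {m = suc m} e (suc i) = tabulate-injective (proj₂ (∷-injective e)) i

enumerate : (xs : List A) → length xs ≡ k → Fin k → A
enumerate xs refl = lookup xs

tabulate-enumerate : (xs : List A) (len : length xs ≡ k) → tabulate (enumerate xs len) ≡ xs
tabulate-enumerate xs refl = tabulate-lookup xs

filter-allFin-increasing : ∀ {n} {P : Pred (Fin n) ℓ} (P? : Decidable P) {f : Fin k → Fin n} →
  filter P? (allFin n) ≡ tabulate f → f Preserves Fin._<_ ⟶ Fin._<_
filter-allFin-increasing P? {f} filter≡f = stepwise⇒ordered {R = Fin._<_} {f} Fin.<-trans
  (linked-tabulate⁻ (subst (Linked Fin._<_) filter≡f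
    (Linked.filter⁺ P? Fin.<-trans (linked-tabulate⁺ λ i j j≡1+i → ≤-reflexive (sym j≡1+i)))))

filter-partition-↭ : {P : Pred A ℓ} (P? : Decidable P) (xs : List A) →
  xs ↭ filter P? xs ++ filter (∁? P?) xs
filter-partition-↭ P? xs = subst (λ parts → xs ↭ proj₁ parts ++ proj₂ parts)
  (partition-defn P? xs) (↭ₛ⇒↭ (partition-↭ P? xs))
  where open PermutationProperties (≡.setoid _) using (partition-↭)

module _ {P : Pred A ℓ} (P? : Decidable P) {ℓ′} {R : Rel A ℓ′} (R? : Decidable₂ R) where

  filter-merge-left : ∀ {xs ys} → All P xs → All (∁ P) ys → filter P? (merge R? xs ys) ≡ xs
  filter-merge-left {[]} [] ys∉P = filter-none P? ys∉P
  filter-merge-left {x ∷ xs} {[]} xs∈P _ = filter-all P? xs∈P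
  filter-merge-left {x ∷ xs} {y ∷ ys} (x∈P ∷ xs∈P) (y∉P ∷ ys∉P)
    with does (R? x y) | filter-merge-left xs∈P (y∉P ∷ ys∉P) | filter-merge-left (x∈P ∷ xs∈P) ys∉P
  ... | true | rec | _ = trans (filter-accept P? x∈P) (cong (x ∷_) rec)
  ... | false | _ | rec = trans (filter-reject P? y∉P) rec

  filter-merge-right : ∀ {xs ys} → All (∁ P) xs → All P ys → filter P? (merge R? xs ys) ≡ ys
  filter-merge-right {[]} [] ys∈P = filter-all P? ys∈P
  filter-merge-right {x ∷ xs} {[]} xs∉P _ = filter-none P? xs∉P
  filter-merge-right {x ∷ xs} {y ∷ ys} (x∉P ∷ xs∉P) (y∈P ∷ ys∈P)
    with does (R? x y) | filter-merge-right xs∉P (y∈P ∷ ys∈P) | filter-merge-right (x∉P ∷ xs∉P) ys∈P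
  ... | true | rec | _ = trans (filter-reject P? x∉P) rec
  ... | false | _ | rec = trans (filter-accept P? y∈P) (cong (y ∷_) rec)

map-filter : ∀ {b} {B : Set b} {P : Pred B ℓ} (f : A → B) (P? : Decidable P) xs →
  map f (filter (P? ∘ f) xs) ≡ filter P? (map f xs)
map-filter f P? [] = refl
map-filter f P? (x ∷ xs) with does (P? (f x))
... | true = cong (f x ∷_) (map-filter f P? xs)
... | false = map-filter f P? xs

lookup-injective : ∀ {xs : List A} → Unique xs → ∀ {i j} → lookup xs i ≡ lookup xs j → i ≡ j
lookup-injective (_ ∷ _) {zero} {zero} _ = refl
lookup-injective (x∉xs ∷ _) {zero} {suc j} x≡xⱼ = contradiction x≡xⱼ (All.lookup x∉xs (∈-lookup j))
lookup-injective (x∉xs ∷ _) {suc i} {zero} xᵢ≡x = contradiction (sym xᵢ≡x) (All.lookup x∉xs (∈-lookup i))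
lookup-injective (_ ∷ xs!) {suc i} {suc j} xᵢ≡xⱼ = cong suc (lookup-injective xs! xᵢ≡xⱼ)

rank : ℕ → List ℕ → ℕ
rank x xs = length (filter (_<? x) xs)

rank-↭ : ∀ x {xs ys} → xs ↭ ys → rank x xs ≡ rank x ys
rank-↭ x p = ↭-length (filter-↭ (_<? x) p)

rank-increasing : (f : Fin k → ℕ) → f Preserves Fin._<_ ⟶ _<_ → ∀ u → rank (f u) (tabulate f) ≡ toℕ u
rank-increasing {suc k} f inc zero = begin
  rank (f zero) (tabulate f)         ≡⟨ cong length (filter-reject (_<? f zero) (<-irrefl refl)) ⟩
  rank (f zero) (tabulate (f ∘ suc)) ≡⟨ cong length (filter-none (_<? f zero) (All.tabulate⁺ later-larger)) ⟩
  0                                  ∎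
  where
  open ≡.≡-Reasoning
  later-larger : ∀ t → ¬ f (suc t) < f zero
  later-larger t = <⇒≯ (inc {zero} {suc t} (s≤s z≤n))
rank-increasing {suc k} f inc (suc u) =
  trans (cong length (filter-accept (_<? f (suc u)) (inc (s≤s z≤n))))
        (cong suc (rank-increasing (f ∘ suc) (λ lt → inc (s≤s lt)) u))

orderCode : ℕ → ℕ → ℕ
orderCode x y with <-cmp x y
... | tri< _ _ _ = 0
... | tri≈ _ _ _ = 1
... | tri> _ _ _ = 2

orderCode-< : ∀ {x y} → x < y → orderCode x y ≡ 0
orderCode-< {x} {y} x<y with <-cmp x y
... | tri< _ _ _ = refl
... | tri≈ _ x≡y _ = contradiction x≡y (<⇒≢ x<y)
... | tri> _ _ y<x = contradiction y<x (<-asym x<y)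

orderCode-refl : ∀ x → orderCode x x ≡ 1
orderCode-refl x with <-cmp x x
... | tri< x<x _ _ = contradiction x<x (<-irrefl refl)
... | tri≈ _ _ _ = refl
... | tri> _ _ x<x = contradiction x<x (<-irrefl refl)

orderCode-> : ∀ {x y} → y < x → orderCode x y ≡ 2
orderCode-> {x} {y} y<x with <-cmp x y
... | tri< x<y _ _ = contradiction y<x (<-asym x<y)
... | tri≈ _ x≡y _ = contradiction (sym x≡y) (<⇒≢ y<x)
... | tri> _ _ _ = refl

orderCode≡1⇒≡ : ∀ {x y} → orderCode x y ≡ 1 → x ≡ y
orderCode≡1⇒≡ {x} {y} c with <-cmp x y
... | tri≈ _ x≡y _ = x≡y

orderCode-increasing : {f : Fin m → ℕ} → f Preserves Fin._<_ ⟶ _<_ →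
  ∀ s t → orderCode (f s) (f t) ≡ orderCode (toℕ s) (toℕ t)
orderCode-increasing {f = f} inc s t with <-cmp (toℕ s) (toℕ t)
... | tri< s<t _ _ = orderCode-< (inc s<t)
... | tri≈ _ s≡t _ rewrite toℕ-injective s≡t = orderCode-refl (f t)
... | tri> _ _ t<s = orderCode-> (inc t<s)

orderCode-step : ∀ {x y a b} → y ≡ suc x → a < b → orderCode a x ≤ orderCode b y
orderCode-step {x} {y} {a} {b} refl a<b with <-cmp a x | <-cmp b (suc x)
... | tri< _ _ _ | _ = z≤n
... | tri≈ _ _ _ | tri≈ _ _ _ = ≤-refl
... | tri≈ _ _ _ | tri> _ _ _ = s≤s z≤n
... | tri> _ _ _ | tri> _ _ _ = ≤-refl
... | tri≈ _ refl _ | tri< b≤x _ _ = contradiction a<b (≤⇒≯ (≤-pred b≤x))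
... | tri> _ _ x<a | tri< b≤x _ _ = contradiction (<-trans x<a a<b) (≤⇒≯ (≤-pred b≤x))
... | tri> _ _ x<a | tri≈ _ refl _ = contradiction x<a (≤⇒≯ (≤-pred a<b))

orderCode-≤⇒< : ∀ {x y a b} → x < y → orderCode a x ≤ orderCode b y → a ≡ x ⊎ b ≡ y → a < b
orderCode-≤⇒< {x} {y} {a} {b} x<y c fixed with <-cmp a x | <-cmp b y
... | tri< _ a≢x _ | tri< _ b≢y _ = [ flip contradiction a≢x , flip contradiction b≢y ] fixed
... | tri< a<x _ _ | tri≈ _ refl _ = <-trans a<x x<y
... | tri< a<x _ _ | tri> _ _ y<b = <-trans (<-trans a<x x<y) y<b
... | tri≈ _ refl _ | tri≈ _ refl _ = x<y
... | tri≈ _ refl _ | tri> _ _ y<b = <-trans x<y y<b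
... | tri> _ a≢x _ | tri> _ b≢y _ = [ flip contradiction a≢x , flip contradiction b≢y ] fixed
orderCode-≤⇒< _ () _ | tri≈ _ _ _ | tri< _ _ _
orderCode-≤⇒< _ () _ | tri> _ _ _ | tri< _ _ _
orderCode-≤⇒< _ (s≤s ()) _ | tri> _ _ _ | tri≈ _ _ _

Key : Set
Key = ℕ × ℕ

infix 4 _≼_
_≼_ : Rel Key 0ℓ
(a , x) ≼ (b , y) = b < a ⊎ (a ≡ b × x ≤ y)

≼-reflexive : ∀ {p q} → p ≡ q → p ≼ q
≼-reflexive refl = inj₂ (refl , ≤-refl)

≼-trans : Transitive _≼_
≼-trans (inj₁ b<a) (inj₁ c<b) = inj₁ (<-trans c<b b<a)
≼-trans (inj₁ b<a) (inj₂ (refl , _)) = inj₁ b<a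
≼-trans (inj₂ (refl , _)) (inj₁ c<b) = inj₁ c<b
≼-trans (inj₂ (refl , x≤y)) (inj₂ (refl , y≤z)) = inj₂ (refl , ≤-trans x≤y y≤z)

≼-antisym : ∀ {p q} → p ≼ q → q ≼ p → p ≡ q
≼-antisym (inj₁ b<a) (inj₁ a<b) = contradiction a<b (<-asym b<a)
≼-antisym (inj₁ b<a) (inj₂ (refl , _)) = contradiction b<a (<-irrefl refl)
≼-antisym (inj₂ (refl , _)) (inj₁ a<b) = contradiction a<b (<-irrefl refl)
≼-antisym (inj₂ (refl , x≤y)) (inj₂ (_ , y≤x)) = cong (_ ,_) (≤-antisym x≤y y≤x)

≼-total : ∀ p q → p ≼ q ⊎ q ≼ p
≼-total (a , x) (b , y) with <-cmp a b | ≤-total x y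
... | tri< a<b _ _ | _ = inj₂ (inj₁ a<b)
... | tri> _ _ b<a | _ = inj₁ (inj₁ b<a)
... | tri≈ _ refl _ | inj₁ x≤y = inj₁ (inj₂ (refl , x≤y))
... | tri≈ _ refl _ | inj₂ y≤x = inj₂ (inj₂ (refl , y≤x))

_≼?_ : ∀ p q → Dec (p ≼ q)
(a , x) ≼? (b , y) = (b <? a) ⊎-dec ((a ≟ℕ b) ×-dec (x ≤?ℕ y))

≼-decTotalOrder : DecTotalOrder 0ℓ 0ℓ 0ℓ
≼-decTotalOrder = record
  { Carrier = Key
  ; _≈_ = _≡_
  ; _≤_ = _≼_
  ; isDecTotalOrder = record
    { isTotalOrder = record
      { isPartialOrder = record
        { isPreorder = record { isEquivalence = ≡.isEquivalence ; reflexive = ≼-reflexive ; trans = ≼-trans }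
        ; antisym = ≼-antisym
        }
      ; total = ≼-total
      }
    ; _≟_ = ≡-dec _≟ℕ_ _≟ℕ_
    ; _≤?_ = _≼?_
    }
  }

sorted-↭⇒≡ : {xs ys : List Key} → Linked _≼_ xs → Linked _≼_ ys → xs ↭ ys → xs ≡ ys
sorted-↭⇒≡ xs↗ ys↗ xs↭ys =
  Pointwise-≡⇒≡ (↗↭↗⇒≋ (DecTotalOrder.totalOrder ≼-decTotalOrder) xs↗ ys↗ (↭⇒↭ₛ xs↭ys))

module _ {lam : Fin m → ℕ} {π : Fin m → Fin m} (standard : IsStandardLabeled lam π) where

  private
    part = proj₁ standard
    π-injective = proj₁ (proj₁ (proj₂ standard))
    descent⇒drop = proj₂ (proj₂ standard)

    levelKey : Fin m → Key
    levelKey i = lam i , toℕ (π i)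

    levelKey-stepwise : Stepwise _≼_ levelKey
    levelKey-stepwise i j j≡1+i with m≤n⇒m<n∨m≡n (part i j j≡1+i)
    ... | inj₁ drop = inj₁ drop
    ... | inj₂ level = inj₂ (sym level , ≮⇒≥ λ descent → <⇒≢ (descent⇒drop i j j≡1+i descent) level)

  standard-ascent-on-level : ∀ {s t} → toℕ s < toℕ t → lam s ≡ lam t → toℕ (π s) < toℕ (π t)
  standard-ascent-on-level {s} {t} s<t level
    with stepwise⇒ordered {R = _≼_} {levelKey} ≼-trans levelKey-stepwise s<t
  ... | inj₁ drop = contradiction (sym level) (<⇒≢ drop)
  ... | inj₂ (_ , πs≤πt) = ≤∧≢⇒< πs≤πt (λ e → <⇒≢ s<t (cong toℕ (π-injective (toℕ-injective e))))

-- IsPartition lam is, definitionally, Stepwise _≥_ lam.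
partition-antitone : {lam : Fin m → ℕ} → IsPartition lam → ∀ {s t} → toℕ s < toℕ t → lam t ≤ lam s
partition-antitone {lam = lam} part = stepwise⇒ordered {R = _≥_} {lam} (flip ≤-trans) part

module DerangementEnumeration {n k : ℕ} {π : Fin n → Fin n} (π-perm : IsPerm π)
  (J : Fin k → Fin n) (J-enumerates : derangPts π ≡ tabulate J) where

  π-injective : ∀ {p q} → π p ≡ π q → p ≡ q
  π-injective = proj₁ π-perm

  J-increasing : J Preserves Fin._<_ ⟶ Fin._<_
  J-increasing = filter-allFin-increasing (λ i → ¬? (π i ≟ i)) J-enumerates

  J-reflects : ∀ {s t} → toℕ (J s) < toℕ (J t) → toℕ s < toℕ t
  J-reflects {s} {t} Js<Jt with <-cmp (toℕ s) (toℕ t)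
  ... | tri< s<t _ _ = s<t
  ... | tri≈ _ s≡t _ = contradiction (cong (toℕ ∘ J) (toℕ-injective s≡t)) (<⇒≢ Js<Jt)
  ... | tri> _ _ t<s = contradiction (J-increasing t<s) (<⇒≯ Js<Jt)

  J-injective : ∀ {s t} → J s ≡ J t → s ≡ t
  J-injective {s} {t} Js≡Jt with <-cmp (toℕ s) (toℕ t)
  ... | tri< s<t _ _ = contradiction (cong toℕ Js≡Jt) (<⇒≢ (J-increasing s<t))
  ... | tri≈ _ s≡t _ = toℕ-injective s≡t
  ... | tri> _ _ t<s = contradiction (cong toℕ (sym Js≡Jt)) (<⇒≢ (J-increasing t<s))

  J-deranged : ∀ t → π (J t) ≢ J t
  J-deranged t = proj₂ (∈-filter⁻ (λ i → ¬? (π i ≟ i)) {xs = allFin n}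
    (subst (J t ∈_) (sym J-enumerates) (∈-tabulate⁺ t)))

  deranged⇒enumerated : ∀ {p} → π p ≢ p → ∃ λ t → p ≡ J t
  deranged⇒enumerated {p} πp≢p = ∈-tabulate⁻ (subst (p ∈_) J-enumerates
    (∈-filter⁺ (λ i → ¬? (π i ≟ i)) (∈-allFin p) πp≢p))

  J-closed : ∀ t → ∃ λ u → π (J t) ≡ J u
  J-closed t = deranged⇒enumerated λ ππJt≡πJt → J-deranged t (π-injective ππJt≡πJt)

  preimage-deranged : ∀ {p u} → π p ≡ J u → π p ≢ p
  preimage-deranged {u = u} πp≡Ju πp≡p = J-deranged u (trans (cong π (trans (sym πp≡Ju) πp≡p)) πp≡Ju)

  J-onto : ∀ u → ∃ λ t → π (J t) ≡ J u
  J-onto u with proj₂ π-perm (J u)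
  ... | p , πp≡Ju with deranged⇒enumerated (preimage-deranged (πp≡Ju refl))
  ...   | t , refl = t , πp≡Ju refl

  dp-pattern : (ρ : Fin k → Fin k) → (∀ t → π (J t) ≡ J (ρ t)) → dp π ≡ oneLine ρ
  dp-pattern ρ πJ≡Jρ = begin
    dp π                                     ≡⟨ cong std values ⟩
    map (λ x → rank x V) V                   ≡⟨ map-cong (λ x → rank-↭ x V↭Jℕ) V ⟩
    map (λ x → rank x Jℕ) V                  ≡⟨ map-tabulate (toℕ ∘ J ∘ ρ) (λ x → rank x Jℕ) ⟩
    tabulate (λ t → rank (toℕ (J (ρ t))) Jℕ) ≡⟨ tabulate-cong (rank-increasing (toℕ ∘ J) J-increasing ∘ ρ) ⟩
    oneLine ρ                                ∎
    where
    open ≡.≡-Reasoning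
    Jℕ V : List ℕ
    Jℕ = tabulate (toℕ ∘ J)
    V = tabulate (toℕ ∘ J ∘ ρ)

    values : map (λ i → toℕ (π i)) (derangPts π) ≡ V
    values = trans (cong (map (λ i → toℕ (π i))) J-enumerates)
                   (trans (map-tabulate J (λ i → toℕ (π i))) (tabulate-cong (cong toℕ ∘ πJ≡Jρ)))

    ρ-injective : ∀ {s t} → ρ s ≡ ρ t → s ≡ t
    ρ-injective {s} {t} e = J-injective (π-injective (trans (πJ≡Jρ s) (trans (cong J e) (sym (πJ≡Jρ t)))))

    V⊆Jℕ : ∀ {x} → x ∈ V → x ∈ Jℕ
    V⊆Jℕ x∈V with ∈-tabulate⁻ x∈V
    ... | t , refl = ∈-tabulate⁺ (ρ t)

    Jℕ⊆V : ∀ {x} → x ∈ Jℕ → x ∈ V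
    Jℕ⊆V x∈Jℕ with ∈-tabulate⁻ x∈Jℕ
    ... | u , refl with J-onto u
    ...   | t , πJt≡Ju = subst (_∈ V) (cong toℕ (trans (sym (πJ≡Jρ t)) πJt≡Ju)) (∈-tabulate⁺ t)

    V↭Jℕ : V ↭ Jℕ
    V↭Jℕ = ∼bag⇒↭ (unique∧set⇒bag
      (AllPairs.tabulate⁺ λ s≢t e → s≢t (ρ-injective (J-injective (toℕ-injective e))))
      (AllPairs.tabulate⁺ λ s≢t e → s≢t (J-injective (toℕ-injective e)))
      (mk⇔ V⊆Jℕ Jℕ⊆V))

  dp-pattern⁻ : (σ : Fin k → Fin k) → dp π ≡ oneLine σ → ∀ t → π (J t) ≡ J (σ t)
  dp-pattern⁻ σ dp≡σ t = trans πJt≡Jρt (cong J (toℕ-injective (tabulate-injective oneLineρ≡σ t)))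
    where
    ρ : Fin k → Fin k
    ρ = proj₁ ∘ J-closed
    πJt≡Jρt = proj₂ (J-closed t)
    oneLineρ≡σ : oneLine ρ ≡ oneLine σ
    oneLineρ≡σ = trans (sym (dp-pattern ρ (proj₂ ∘ J-closed))) dp≡σ

positionKey : (Fin m → ℕ) → (Fin m → Fin m) → Fin m → Key
positionKey μ π p = μ p , orderCode (toℕ (π p)) (toℕ p)

labelKey : ∀ {r} → (Fin k → ℕ) → (Fin k → Fin k) → (Fin r → ℕ) → Fin k ⊎ Fin r → Key
labelKey β σ γ (inj₁ t) = β t , orderCode (toℕ (σ t)) (toℕ t)
labelKey β σ γ (inj₂ s) = γ s , 1

positionKey-stepwise : {μ : Fin m → ℕ} {π : Fin m → Fin m} → IsStandardLabeled μ π →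
  Stepwise _≼_ (positionKey μ π)
positionKey-stepwise standard p q q≡1+p with m≤n⇒m<n∨m≡n (proj₁ standard p q q≡1+p)
... | inj₁ drop = inj₁ drop
... | inj₂ level = inj₂ (sym level , orderCode-step q≡1+p
        (standard-ascent-on-level standard (≤-reflexive (sym q≡1+p)) (sym level)))

positionKey≗⇒fixed : {μ μ′ : Fin m → ℕ} {π π′ : Fin m → Fin m} → positionKey μ π ≗ positionKey μ′ π′ →
  ∀ {p} → π p ≡ p → π′ p ≡ p
positionKey≗⇒fixed {π = π} {π′} keys≗ {p} πp≡p = toℕ-injective (orderCode≡1⇒≡ (begin
  orderCode (toℕ (π′ p)) (toℕ p) ≡⟨ cong proj₂ (keys≗ p) ⟨
  orderCode (toℕ (π p)) (toℕ p)  ≡⟨ cong (λ q → orderCode (toℕ q) (toℕ p)) πp≡p ⟩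
  orderCode (toℕ p) (toℕ p)      ≡⟨ orderCode-refl (toℕ p) ⟩
  1                              ∎))
  where open ≡.≡-Reasoning

module Decomposition {n k : ℕ} {σ : Fin k → Fin k} {μ : Fin n → ℕ} {π : Fin n → Fin n}
  (a : InA σ μ π) where

  private
    standard = proj₁ a
    π-perm = proj₁ (proj₂ standard)

  derangPts-length : length (derangPts π) ≡ k
  derangPts-length = begin
    length (derangPts π)      ≡⟨ length-map (λ i → toℕ (π i)) (derangPts π) ⟨
    length (map (λ i → toℕ (π i)) (derangPts π)) ≡⟨ length-map _ (map (λ i → toℕ (π i)) (derangPts π)) ⟨
    length (dp π)             ≡⟨ cong length (proj₂ a) ⟩
    length (oneLine σ)        ≡⟨ length-tabulate _ ⟩
    k                         ∎
    where open ≡.≡-Reasoning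

  allFin-↭ : allFin n ↭ fixPts π ++ derangPts π
  allFin-↭ = filter-partition-↭ (λ i → π i ≟ i) (allFin n)

  fixPts-length : length (fixPts π) ≡ n ∸ k
  fixPts-length = begin
    length (fixPts π)                               ≡⟨ m+n∸n≡m _ k ⟨
    length (fixPts π) + k ∸ k                       ≡⟨ cong (λ l → length (fixPts π) + l ∸ k) derangPts-length ⟨
    length (fixPts π) + length (derangPts π) ∸ k    ≡⟨ cong (_∸ k) (length-++ (fixPts π)) ⟨
    length (fixPts π ++ derangPts π) ∸ k            ≡⟨ cong (_∸ k) (↭-length allFin-↭) ⟨
    length (allFin n) ∸ k                           ≡⟨ cong (_∸ k) (length-tabulate _) ⟩
    n ∸ k                                           ∎
    where open ≡.≡-Reasoning

  J : Fin k → Fin n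
  J = enumerate (derangPts π) derangPts-length

  J-enumerates : derangPts π ≡ tabulate J
  J-enumerates = sym (tabulate-enumerate (derangPts π) derangPts-length)

  open DerangementEnumeration π-perm J J-enumerates public

  πJ≡Jσ : ∀ t → π (J t) ≡ J (σ t)
  πJ≡Jσ = dp-pattern⁻ σ (proj₂ a)

  I : Fin (n ∸ k) → Fin n
  I = enumerate (fixPts π) fixPts-length

  I-enumerates : fixPts π ≡ tabulate I
  I-enumerates = sym (tabulate-enumerate (fixPts π) fixPts-length)

  I-fixed : ∀ s → π (I s) ≡ I s
  I-fixed s = proj₂ (∈-filter⁻ (λ i → π i ≟ i) {xs = allFin n}
    (subst (I s ∈_) (sym I-enumerates) (∈-tabulate⁺ s)))

  tabulate-split-↭ : (f : Fin n → A) → tabulate f ↭ tabulate (f ∘ I) ++ tabulate (f ∘ J)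
  tabulate-split-↭ f = begin
    tabulate f                                ≡⟨ map-tabulate (λ i → i) f ⟨
    map f (allFin n)                          ↭⟨ map⁺ f allFin-↭ ⟩
    map f (fixPts π ++ derangPts π)           ≡⟨ map-++ f (fixPts π) (derangPts π) ⟩
    map f (fixPts π) ++ map f (derangPts π)   ≡⟨ cong₂ (λ xs ys → map f xs ++ map f ys) I-enumerates J-enumerates ⟩
    map f (tabulate I) ++ map f (tabulate J)  ≡⟨ cong₂ _++_ (map-tabulate I f) (map-tabulate J f) ⟩
    tabulate (f ∘ I) ++ tabulate (f ∘ J)      ∎
    where open PermutationReasoning

  β : Fin k → ℕ
  β = μ ∘ J

  γ : Fin (n ∸ k) → ℕ
  γ = μ ∘ I

  φ≡ : φ μ π ≡ (tabulate β , tabulate γ)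
  φ≡ = cong₂ _,_ (trans (cong (map μ) J-enumerates) (map-tabulate J μ))
                 (trans (cong (map μ) I-enumerates) (map-tabulate I μ))

  size≡ : size μ ≡ size β + size γ
  size≡ = begin
    sum (tabulate μ)                          ≡⟨ sum-↭ (tabulate-split-↭ μ) ⟩
    sum (tabulate γ ++ tabulate β)            ≡⟨ sum-++ (tabulate γ) (tabulate β) ⟩
    size γ + size β                           ≡⟨ +-comm (size γ) (size β) ⟩
    size β + size γ                           ∎
    where open ≡.≡-Reasoning

  I-increasing : I Preserves Fin._<_ ⟶ Fin._<_
  I-increasing = filter-allFin-increasing (λ i → π i ≟ i) I-enumerates

  γ-partition : IsPartition γ
  γ-partition s s′ s′≡1+s = partition-antitone (proj₁ standard) (I-increasing (≤-reflexive (sym s′≡1+s)))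

  β-standard : IsPerm σ → IsStandardLabeled β σ
  β-standard σ-perm = β-partition , σ-perm , descent⇒drop
    where
    β-partition : IsPartition β
    β-partition t t′ t′≡1+t = partition-antitone (proj₁ standard) (J-increasing (≤-reflexive (sym t′≡1+t)))

    descent⇒drop : ∀ t t′ → toℕ t′ ≡ suc (toℕ t) → toℕ (σ t′) < toℕ (σ t) → β t′ < β t
    descent⇒drop t t′ t′≡1+t descent with m≤n⇒m<n∨m≡n (β-partition t t′ t′≡1+t)
    ... | inj₁ drop = drop
    ... | inj₂ level = contradiction (J-reflects (subst₂ (λ p q → toℕ p < toℕ q) (πJ≡Jσ t) (πJ≡Jσ t′) πJt<πJt′))
                                     (<⇒≯ descent)
      where
      πJt<πJt′ : toℕ (π (J t)) < toℕ (π (J t′))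
      πJt<πJt′ = standard-ascent-on-level standard (J-increasing (≤-reflexive (sym t′≡1+t))) (sym level)

  keys-↭ : tabulate (positionKey μ π) ↭
           tabulate (labelKey β σ γ ∘ inj₂) ++ tabulate (labelKey β σ γ ∘ inj₁)
  keys-↭ = subst (tabulate (positionKey μ π) ↭_)
    (cong₂ _++_ (tabulate-cong fixedKey) (tabulate-cong derangedKey)) (tabulate-split-↭ (positionKey μ π))
    where
    fixedKey : ∀ s → positionKey μ π (I s) ≡ (γ s , 1)
    fixedKey s = cong (γ s ,_) (trans (cong (λ q → orderCode (toℕ q) (toℕ (I s))) (I-fixed s)) (orderCode-refl _))

    derangedKey : ∀ t → positionKey μ π (J t) ≡ labelKey β σ γ (inj₁ t)
    derangedKey t = cong (β t ,_) (trans (cong (λ q → orderCode (toℕ q) (toℕ (J t))) (πJ≡Jσ t))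
                                         (orderCode-increasing J-increasing (σ t) t))

φ-into-B : {n k : ℕ} {σ : Fin k → Fin k} → IsPerm σ → (μ : Fin n → ℕ) (π : Fin n → Fin n) → InA σ μ π →
  Σ (Fin k → ℕ) λ β → Σ (Fin (n ∸ k) → ℕ) λ γ →
    InB σ β γ × φ μ π ≡ (tabulate β , tabulate γ) × size μ ≡ size β + size γ
φ-into-B σ-perm μ π a = β , γ , (β-standard σ-perm , γ-partition) , φ≡ , size≡
  where open Decomposition a

φ-injective : {n k : ℕ} {σ : Fin k → Fin k} (μ μ′ : Fin n → ℕ) (π π′ : Fin n → Fin n) →
  InA σ μ π → InA σ μ′ π′ → φ μ π ≡ φ μ′ π′ → (∀ i → μ i ≡ μ′ i) × (∀ i → π i ≡ π′ i)
φ-injective {n} {σ = σ} μ μ′ π π′ a a′ φ≡φ′ = μ≗μ′ , π≗π′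
  where
  module D = Decomposition a
  module D′ = Decomposition a′

  parts≡ : (tabulate D.β , tabulate D.γ) ≡ (tabulate D′.β , tabulate D′.γ)
  parts≡ = trans (sym D.φ≡) (trans φ≡φ′ D′.φ≡)

  labelKeys≡ : tabulate (labelKey D.β σ D.γ ∘ inj₂) ++ tabulate (labelKey D.β σ D.γ ∘ inj₁)
          ≡ tabulate (labelKey D′.β σ D′.γ ∘ inj₂) ++ tabulate (labelKey D′.β σ D′.γ ∘ inj₁)
  labelKeys≡ = cong₂ _++_
    (tabulate-cong λ s → cong (_, 1) (tabulate-injective (cong proj₂ parts≡) s))
    (tabulate-cong λ t → cong (_, _) (tabulate-injective (cong proj₁ parts≡) t))

  keys≗ : positionKey μ π ≗ positionKey μ′ π′
  keys≗ = tabulate-injective (sorted-↭⇒≡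
    (linked-tabulate⁺ (positionKey-stepwise (proj₁ a)))
    (linked-tabulate⁺ (positionKey-stepwise (proj₁ a′)))
    (↭-trans D.keys-↭ (subst (_↭ _) (sym labelKeys≡) (↭-sym D′.keys-↭))))

  μ≗μ′ : ∀ i → μ i ≡ μ′ i
  μ≗μ′ i = cong proj₁ (keys≗ i)

  derangPts≡ : derangPts π ≡ derangPts π′
  derangPts≡ = filter-≐ (λ i → ¬? (π i ≟ i)) (λ i → ¬? (π′ i ≟ i))
    ((λ deranged fixed′ → deranged (positionKey≗⇒fixed (sym ∘ keys≗) fixed′)) ,
     (λ deranged′ fixed → deranged′ (positionKey≗⇒fixed keys≗ fixed)))
    (allFin n)

  J≗J′ : D.J ≗ D′.J
  J≗J′ = tabulate-injective (trans (sym D.J-enumerates) (trans derangPts≡ D′.J-enumerates))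

  π≗π′ : ∀ p → π p ≡ π′ p
  π≗π′ p with π p ≟ p
  ... | yes fixed = trans fixed (sym (positionKey≗⇒fixed keys≗ fixed))
  ... | no deranged with D.deranged⇒enumerated deranged
  ...   | t , refl = begin
    π (D.J t)      ≡⟨ D.πJ≡Jσ t ⟩
    D.J (σ t)      ≡⟨ J≗J′ (σ t) ⟩
    D′.J (σ t)     ≡⟨ D′.πJ≡Jσ t ⟨
    π′ (D′.J t)    ≡⟨ cong π′ (J≗J′ t) ⟨
    π′ (D.J t)     ∎
    where open ≡.≡-Reasoning

module Reconstruction {k r : ℕ} {σ : Fin k → Fin k} (σ-derangement : IsDerangement σ)
  {β : Fin k → ℕ} {γ : Fin r → ℕ} (b : InB σ β γ) where

  private
    σ-perm = proj₁ σ-derangement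
    β-standard = proj₁ b
    key = labelKey β σ γ

  Left : Pred (Fin k ⊎ Fin r) 0ℓ
  Left (inj₁ _) = ⊤
  Left (inj₂ _) = ⊥

  left? : Decidable Left
  left? (inj₁ _) = yes tt
  left? (inj₂ _) = no λ ()

  labelOrder : DecTotalOrder 0ℓ 0ℓ 0ℓ
  labelOrder = On.decTotalOrder ≼-decTotalOrder key

  open DecTotalOrder labelOrder using (_≤?_)

  lefts rights labels : List (Fin k ⊎ Fin r)
  lefts = tabulate inj₁
  rights = tabulate inj₂
  labels = merge _≤?_ lefts rights

  labels-↭ : labels ↭ lefts ++ rights
  labels-↭ = merge-↭ _≤?_ lefts rights

  labels-length : length labels ≡ k + r
  labels-length = trans (↭-length labels-↭)
    (trans (length-++ lefts {rights}) (cong₂ _+_ (length-tabulate {n = k} inj₁) (length-tabulate {n = r} inj₂)))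

  labels-complete : ∀ x → x ∈ labels
  labels-complete (inj₁ t) = ∈-resp-↭ (↭-sym labels-↭) (∈-++⁺ˡ (∈-tabulate⁺ t))
  labels-complete (inj₂ s) = ∈-resp-↭ (↭-sym labels-↭) (∈-++⁺ʳ lefts (∈-tabulate⁺ s))

  labels-unique : Unique labels
  labels-unique = Unique-resp-↭ (↭⇒↭ₛ (↭-sym labels-↭)) (Unique.++⁺
    (AllPairs.tabulate⁺ λ s≢t e → s≢t (inj₁-injective e))
    (AllPairs.tabulate⁺ λ s≢t e → s≢t (inj₂-injective e))
    λ (l , r) → left≢right (∈-tabulate⁻ l) (∈-tabulate⁻ r))
    where
    open PermutationProperties (≡.setoid (Fin k ⊎ Fin r)) using (Unique-resp-↭)
    left≢right : ∀ {x} → ∃ (λ t → x ≡ inj₁ t) → ∃ (λ s → x ≡ inj₂ s) → ⊥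
    left≢right (t , refl) (s , ())

  labels-sorted : Stepwise _≼_ (key ∘ lookup labels)
  labels-sorted = linked-tabulate⁻ (subst (Linked _) (sym (tabulate-lookup labels))
    (merge⁺ labelOrder (linked-tabulate⁺ (positionKey-stepwise β-standard)) (linked-tabulate⁺ rights-stepwise)))
    where
    rights-stepwise : Stepwise _≼_ (key ∘ inj₂)
    rights-stepwise s s′ s′≡1+s with m≤n⇒m<n∨m≡n (proj₂ b s s′ s′≡1+s)
    ... | inj₁ drop = inj₁ drop
    ... | inj₂ level = inj₂ (sym level , ≤-refl)

  N : ℕ
  N = length labels

  label : Fin N → Fin k ⊎ Fin r
  label = lookup labels

  position : Fin k ⊎ Fin r → Fin N
  position x = Any.index (labels-complete x)

  label-position : ∀ x → label (position x) ≡ x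
  label-position x = sym (lookup-index (labels-complete x))

  position-label : ∀ p → position (label p) ≡ p
  position-label p = lookup-injective labels-unique (label-position (label p))

  relabel : Fin k ⊎ Fin r → Fin k ⊎ Fin r
  relabel = Sum.map σ (λ s → s)

  π : Fin N → Fin N
  π = position ∘ relabel ∘ label

  μ : Fin N → ℕ
  μ = proj₁ ∘ key ∘ label

  J : Fin k → Fin N
  J = position ∘ inj₁

  I : Fin r → Fin N
  I = position ∘ inj₂

  πJ≡Jσ : ∀ t → π (J t) ≡ J (σ t)
  πJ≡Jσ t = cong (position ∘ relabel) (label-position (inj₁ t))

  πI≡I : ∀ s → π (I s) ≡ I s
  πI≡I s = cong (position ∘ relabel) (label-position (inj₂ s))

  π-perm : IsPerm π
  π-perm = π-injective , π-surjective
    where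
    relabel-injective : ∀ {x y} → relabel x ≡ relabel y → x ≡ y
    relabel-injective {inj₁ _} {inj₁ _} e = cong inj₁ (proj₁ σ-perm (inj₁-injective e))
    relabel-injective {inj₂ _} {inj₂ _} e = e

    π-injective : ∀ {p q} → π p ≡ π q → p ≡ q
    π-injective {p} {q} πp≡πq = trans (sym (position-label p)) (trans (cong position
      (relabel-injective (trans (sym (label-position _)) (trans (cong label πp≡πq) (label-position _)))))
      (position-label q))

    unrelabel : Fin k ⊎ Fin r → Fin k ⊎ Fin r
    unrelabel = Sum.map (λ t → proj₁ (proj₂ σ-perm t)) (λ s → s)

    relabel-unrelabel : ∀ x → relabel (unrelabel x) ≡ x
    relabel-unrelabel (inj₁ t) = cong inj₁ (proj₂ (proj₂ σ-perm t) refl)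
    relabel-unrelabel (inj₂ s) = refl

    π-surjective : ∀ q → ∃ λ p → ∀ {p′} → p′ ≡ p → π p′ ≡ q
    π-surjective q = position (unrelabel (label q)) , λ { refl → begin
      position (relabel (label (position (unrelabel (label q))))) ≡⟨ cong (position ∘ relabel) (label-position _) ⟩
      position (relabel (unrelabel (label q)))                    ≡⟨ cong position (relabel-unrelabel (label q)) ⟩
      position (label q)                                          ≡⟨ position-label q ⟩
      q                                                           ∎ }
      where open ≡.≡-Reasoning

  fixed⇔right : ∀ p → (π p ≡ p → ¬ Left (label p)) × (¬ Left (label p) → π p ≡ p)
  fixed⇔right p = fixed⇒right , right⇒fixed
    where
    relabel-moves-left : ∀ x → Left x → relabel x ≢ x
    relabel-moves-left (inj₁ t) _ e = proj₂ σ-derangement t (inj₁-injective e)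

    fixed⇒right : π p ≡ p → ¬ Left (label p)
    fixed⇒right πp≡p l = relabel-moves-left (label p) l (trans (sym (label-position _)) (cong label πp≡p))

    relabel-fixes-right : ∀ x → ¬ Left x → relabel x ≡ x
    relabel-fixes-right (inj₁ _) ¬l = contradiction tt ¬l
    relabel-fixes-right (inj₂ _) _ = refl

    right⇒fixed : ¬ Left (label p) → π p ≡ p
    right⇒fixed ¬l = trans (cong position (relabel-fixes-right (label p) ¬l)) (position-label p)

  filter-positions : {Q : Pred (Fin k ⊎ Fin r) ℓ} (Q? : Decidable Q) →
    filter (Q? ∘ label) (allFin N) ≡ map position (filter Q? labels)
  filter-positions Q? = begin
    filter (Q? ∘ label) (allFin N)                            ≡⟨ map-position-label _ ⟨
    map position (map label (filter (Q? ∘ label) (allFin N)))  ≡⟨ cong (map position) (map-filter label Q? (allFin N)) ⟩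
    map position (filter Q? (map label (allFin N)))           ≡⟨ cong (map position ∘ filter Q?) labels-enumerated ⟩
    map position (filter Q? labels)                           ∎
    where
    open ≡.≡-Reasoning
    map-position-label : ∀ ps → map position (map label ps) ≡ ps
    map-position-label ps = trans (sym (map-∘ ps)) (trans (map-cong position-label ps) (map-id ps))
    labels-enumerated : map label (allFin N) ≡ labels
    labels-enumerated = trans (map-tabulate (λ p → p) label) (tabulate-lookup labels)

  J-enumerates : derangPts π ≡ tabulate J
  J-enumerates = begin
    derangPts π                        ≡⟨ filter-≐ (λ p → ¬? (π p ≟ p)) (left? ∘ label)
                                                   (deranged⇒left , left⇒deranged) (allFin N) ⟩
    filter (left? ∘ label) (allFin N)  ≡⟨ filter-positions left? ⟩
    map position (filter left? labels) ≡⟨ cong (map position) (filter-merge-left left? _≤?_ {lefts} {rights}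
                                                   (All.tabulate⁺ _) (All.tabulate⁺ λ _ ())) ⟩
    map position lefts                 ≡⟨ map-tabulate inj₁ position ⟩
    tabulate J                         ∎
    where
    open ≡.≡-Reasoning
    deranged⇒left : ∀ {p} → π p ≢ p → Left (label p)
    deranged⇒left {p} πp≢p with left? (label p)
    ... | yes l = l
    ... | no ¬l = contradiction (proj₂ (fixed⇔right p) ¬l) πp≢p
    left⇒deranged : ∀ {p} → Left (label p) → π p ≢ p
    left⇒deranged {p} l πp≡p = proj₁ (fixed⇔right p) πp≡p l

  I-enumerates : fixPts π ≡ tabulate I
  I-enumerates = begin
    fixPts π                                ≡⟨ filter-≐ (λ p → π p ≟ p) (∁? left? ∘ label)
                                                 ((λ {p} → proj₁ (fixed⇔right p)) , (λ {p} → proj₂ (fixed⇔right p)))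
                                                 (allFin N) ⟩
    filter (∁? left? ∘ label) (allFin N)    ≡⟨ filter-positions (∁? left?) ⟩
    map position (filter (∁? left?) labels) ≡⟨ cong (map position) (filter-merge-right (∁? left?) _≤?_ {lefts} {rights}
                                                 (All.tabulate⁺ λ _ ¬l → ¬l tt) (All.tabulate⁺ λ _ ())) ⟩
    map position rights                     ≡⟨ map-tabulate inj₂ position ⟩
    tabulate I                              ∎
    where open ≡.≡-Reasoning

  open DerangementEnumeration π-perm J J-enumerates
    using (J-increasing; J-reflects; deranged⇒enumerated; dp-pattern)

  μJ≡β : ∀ t → μ (J t) ≡ β t
  μJ≡β t = cong (proj₁ ∘ key) (label-position (inj₁ t))

  μI≡γ : ∀ s → μ (I s) ≡ γ s
  μI≡γ s = cong (proj₁ ∘ key) (label-position (inj₂ s))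

  φ≡ : φ μ π ≡ (tabulate β , tabulate γ)
  φ≡ = cong₂ _,_
    (trans (cong (map μ) J-enumerates) (trans (map-tabulate J μ) (tabulate-cong μJ≡β)))
    (trans (cong (map μ) I-enumerates) (trans (map-tabulate I μ) (tabulate-cong μI≡γ)))

  key≡positionKey : ∀ p → key (label p) ≡ positionKey μ π p
  key≡positionKey p = trans (at-position (label p)) (cong (positionKey μ π) (position-label p))
    where
    open ≡.≡-Reasoning
    at-position : ∀ x → key x ≡ positionKey μ π (position x)
    at-position (inj₁ t) = cong₂ _,_ (sym (μJ≡β t)) (sym (begin
      orderCode (toℕ (π (J t))) (toℕ (J t)) ≡⟨ cong (λ q → orderCode (toℕ q) (toℕ (J t))) (πJ≡Jσ t) ⟩
      orderCode (toℕ (J (σ t))) (toℕ (J t)) ≡⟨ orderCode-increasing J-increasing (σ t) t ⟩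
      orderCode (toℕ (σ t)) (toℕ t)         ∎))
    at-position (inj₂ s) = cong₂ _,_ (sym (μI≡γ s)) (sym (begin
      orderCode (toℕ (π (I s))) (toℕ (I s)) ≡⟨ cong (λ q → orderCode (toℕ q) (toℕ (I s))) (πI≡I s) ⟩
      orderCode (toℕ (I s)) (toℕ (I s))     ≡⟨ orderCode-refl _ ⟩
      1                                     ∎))

  positionKey-sorted : Stepwise _≼_ (positionKey μ π)
  positionKey-sorted p q q≡1+p = subst₂ _≼_ (key≡positionKey p) (key≡positionKey q) (labels-sorted p q q≡1+p)

  μ-partition : IsPartition μ
  μ-partition p q q≡1+p with positionKey-sorted p q q≡1+p
  ... | inj₁ drop = <⇒≤ drop
  ... | inj₂ (level , _) = ≤-reflexive (sym level)

  descent⇒drop : ∀ p q → toℕ q ≡ suc (toℕ p) → toℕ (π q) < toℕ (π p) → μ q < μ p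
  descent⇒drop p q q≡1+p descent with positionKey-sorted p q q≡1+p
  ... | inj₁ drop = drop
  ... | inj₂ (level , codes) with π p ≟ p | π q ≟ q
  ...   | yes fixed | _ =
    contradiction (orderCode-≤⇒< (≤-reflexive (sym q≡1+p)) codes (inj₁ (cong toℕ fixed))) (<⇒≯ descent)
  ...   | no _ | yes fixed =
    contradiction (orderCode-≤⇒< (≤-reflexive (sym q≡1+p)) codes (inj₂ (cong toℕ fixed))) (<⇒≯ descent)
  ...   | no p-deranged | no q-deranged with deranged⇒enumerated p-deranged | deranged⇒enumerated q-deranged
  ...     | t , refl | t′ , refl = contradiction πp<πq (<⇒≯ descent)
    where
    σt<σt′ : toℕ (σ t) < toℕ (σ t′)
    σt<σt′ = standard-ascent-on-level β-standard (J-reflects (≤-reflexive (sym q≡1+p)))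
      (trans (sym (μJ≡β t)) (trans level (μJ≡β t′)))
    πp<πq : toℕ (π (J t)) < toℕ (π (J t′))
    πp<πq = subst₂ (λ x y → toℕ x < toℕ y) (sym (πJ≡Jσ t)) (sym (πJ≡Jσ t′)) (J-increasing σt<σt′)

  in-A : InA σ μ π
  in-A = (μ-partition , π-perm , descent⇒drop) , dp-pattern σ πJ≡Jσ

φ-surjective : {n k : ℕ} {σ : Fin k → Fin k} → k ≤ n → IsDerangement σ →
  (β : Fin k → ℕ) (γ : Fin (n ∸ k) → ℕ) → InB σ β γ →
  Σ (Fin n → ℕ) λ μ → Σ (Fin n → Fin n) λ π → InA σ μ π × φ μ π ≡ (tabulate β , tabulate γ)
φ-surjective {σ = σ} k≤n σ-derangement β γ b =
  subst (λ N → Σ (Fin N → ℕ) λ μ → Σ (Fin N → Fin N) λ π → InA σ μ π × φ μ π ≡ (tabulate β , tabulate γ))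
        (trans labels-length (m+[n∸m]≡n k≤n))
        (μ , π , in-A , φ≡)
  where open Reconstruction σ-derangement b

theorem2p2 : (n k : ℕ) → k ≤ n → (σ : Fin k → Fin k) → IsDerangement σ →
    -- φ maps 𝒜 into ℬ, and |μ| = |β| + |γ|
    ((μ : Fin n → ℕ) (π : Fin n → Fin n) → InA σ μ π →
      Σ (Fin k → ℕ) λ β → Σ (Fin (n ∸ k) → ℕ) λ γ →
        InB σ β γ × φ μ π ≡ (tabulate β , tabulate γ) × size μ ≡ size β + size γ)
    -- φ is injective on 𝒜
    × ((μ μ′ : Fin n → ℕ) (π π′ : Fin n → Fin n) → InA σ μ π → InA σ μ′ π′ →
      φ μ π ≡ φ μ′ π′ → (∀ i → μ i ≡ μ′ i) × (∀ i → π i ≡ π′ i))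
    -- φ is surjective onto ℬ
    × ((β : Fin k → ℕ) (γ : Fin (n ∸ k) → ℕ) → InB σ β γ →
      Σ (Fin n → ℕ) λ μ → Σ (Fin n → Fin n) λ π →
        InA σ μ π × φ μ π ≡ (tabulate β , tabulate γ))
theorem2p2 n k k≤n σ σ-derangement =
  φ-into-B (proj₁ σ-derangement) , φ-injective , φ-surjective k≤n σ-derangement
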